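{- Let $(X,*)$ be a finite connected quandle whose profile has no repeats, i.e., the cycle structure of one (equivalently, every) right translation has no two cycles of equal length. Then $(X,*)$ is a latin quandle.
   Context: A quandle is a set $X$ with a binary operation $*$ such that for all $i,j,k\in X$: (i) $i*i=i$; (ii) there exists a unique $x\in X$ with $x*j=i$; (iii) $(i*j)*k=(i*k)*(j*k)$. For $i\in X$, the right translation is $R_i:X\to X$, $j\mapsto j*i$, and the left translation is $L_i: j\mapsto i*j$. A quandle is connected if the group generated by all right translations acts transitively on $X$; in a finite connected quandle all right translations have the same cycle structure (the multiset of cycle lengths in the disjoint cycle decomposition, fixed points counted as cycles of length $1$), and this common cycle structure is called the profile of the quandle. A quandle is latin if every left translation is a permutation of $X$. -}

module Defs where

open import Data.Nat using (ℕ; zero; suc; _<_)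
open import Data.Fin using (Fin)
open import Data.Sum using (_⊎_)
open import Data.Product using (Σ; _×_; ∃; ∃-syntax)
open import Relation.Binary.PropositionalEquality using (_≡_; _≢_)
open import Relation.Binary.Construct.Closure.ReflexiveTransitive using (Star)
open import Function.Definitions using (Bijective)

-- A binary operation on the finite set Fin n (every finite set is in bijection with some Fin n).
BinOp : ℕ → Set
BinOp n = Fin n → Fin n → Fin n

record IsQuandle {n : ℕ} (_∗_ : BinOp n) : Set where
  field
    idem     : ∀ i → i ∗ i ≡ i
    rightDiv : ∀ i j → Σ (Fin n) λ x → (x ∗ j ≡ i) × (∀ y → y ∗ j ≡ i → y ≡ x)
    selfDist : ∀ i j k → (i ∗ j) ∗ k ≡ (i ∗ k) ∗ (j ∗ k)

R : {n : ℕ} → BinOp n → Fin n → Fin n → Fin n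
R _∗_ i j = j ∗ i

L : {n : ℕ} → BinOp n → Fin n → Fin n → Fin n
L _∗_ i j = i ∗ j

-- One generator step of the group generated by the right translations:
-- x goes to y by R_i or by R_i⁻¹ for some i.
Step : {n : ℕ} → BinOp n → Fin n → Fin n → Set
Step {n} _∗_ x y = Σ (Fin n) λ i → (y ≡ x ∗ i) ⊎ (x ≡ y ∗ i)

-- Connected: the group generated by right translations (words in R_i^{±1})
-- acts transitively.
Connected : {n : ℕ} → BinOp n → Set
Connected {n} _∗_ = ∀ (x y : Fin n) → Star (Step _∗_) x y

iter : {A : Set} → (A → A) → ℕ → A → A
iter f zero    a = a
iter f (suc k) a = f (iter f k a)

CycleLength : {A : Set} → (A → A) → A → ℕ → Set
CycleLength f j k = (0 < k) × (iter f k j ≡ j) × (∀ m → 0 < m → m < k → iter f m j ≢ j)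

SameCycle : {A : Set} → (A → A) → A → A → Set
SameCycle f j j' = ∃[ m ] iter f m j ≡ j'

NoRepeatedCycleLengths : {A : Set} → (A → A) → Set
NoRepeatedCycleLengths {A} f =
  ∀ (j j' : A) (k : ℕ) → CycleLength f j k → CycleLength f j' k → SameCycle f j j'

ProfileNoRepeats : {n : ℕ} → BinOp n → Set
ProfileNoRepeats {n} _∗_ = ∀ (i : Fin n) → NoRepeatedCycleLengths (R _∗_ i)

Latin : {n : ℕ} → BinOp n → Set
Latin {n} _∗_ = ∀ (i : Fin n) → Bijective _≡_ _≡_ (L _∗_ i)

-- Fix e and write ζ = R_e.  Self-distributivity makes ζ an automorphism commuting
-- with L_e, so L_e maps each ζ-cycle into a cycle whose length divides the original one.
-- Conversely, if e * x = e * x', then R_{x'}⁻¹ ∘ R_x commutes with ζ, and since R_x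
-- fixes only x (its fixed points are cycles of length 1), every power of ζ fixing x'
-- also fixes x.  By induction on the cycle length, L_e therefore preserves cycle
-- lengths; as cycle lengths are not repeated, e * a lies in the ζ-cycle of a, which
-- makes L_e surjective, and the stabiliser of x in ⟨ζ⟩ equals that of e * x, which
-- makes L_e injective.
module Submission where

open import Defs
open import Data.Nat using (ℕ; zero; suc; _+_; _∸_; _<_; _≤_; _<?_; s≤s)
open import Data.Nat.Properties
  using (anyUpTo?; ≤∧≮⇒≡; ≮⇒≥; n<1+n; m<n⇒0<n∸m; m+[n∸m]≡n; <⇒≤)
open import Data.Nat.Induction using (<-rec)
open import Data.Fin using (Fin; toℕ)
open import Data.Fin.Properties using (pigeonhole; _≟_)
open import Data.Product using (_×_; _,_; ∃-syntax; proj₁; proj₂)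
open import Function.Definitions using (Injective; Surjective)
open import Function.Consequences.Propositional using (strictlySurjective⇒surjective)
open import Relation.Nullary using (¬_; yes; no)
open import Relation.Nullary.Decidable using (_×-dec_)
open import Relation.Unary using (Pred; Decidable)
open import Relation.Binary.PropositionalEquality
open ≡-Reasoning

module _ {A : Set} {f : A → A} where

  iter-+ : ∀ m k x → iter f (m + k) x ≡ iter f m (iter f k x)
  iter-+ zero    k x = refl
  iter-+ (suc m) k x = cong f (iter-+ m k x)

  iter-injective : Injective _≡_ _≡_ f → ∀ m {x y} → iter f m x ≡ iter f m y → x ≡ y
  iter-injective inj zero    eq = eq
  iter-injective inj (suc m) eq = iter-injective inj m (inj eq)

  iter-fixed : ∀ {x} → f x ≡ x → ∀ m → iter f m x ≡ x
  iter-fixed fx≡x zero    = refl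
  iter-fixed fx≡x (suc m) = trans (cong f (iter-fixed fx≡x m)) fx≡x

  iter-commute : {g : A → A} → (∀ y → g (f y) ≡ f (g y)) → ∀ m x → g (iter f m x) ≡ iter f m (g x)
  iter-commute g∘f≡f∘g zero    x = refl
  iter-commute g∘f≡f∘g (suc m) x = trans (g∘f≡f∘g _) (cong f (iter-commute g∘f≡f∘g m x))

  iter-commute-fixed : {g : A → A} → (∀ y → g (f y) ≡ f (g y)) →
    ∀ m {x} → iter f m x ≡ x → iter f m (g x) ≡ g x
  iter-commute-fixed {g} g∘f≡f∘g m {x} fix = trans (sym (iter-commute g∘f≡f∘g m x)) (cong g fix)

  iter-iter-fixed : ∀ t m {x} → iter f m x ≡ x → iter f m (iter f t x) ≡ iter f t x
  iter-iter-fixed t = iter-commute-fixed (λ y → sym (iter-commute {g = f} (λ _ → refl) t y))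

  iter-homomorphic : {_·_ : A → A → A} → (∀ p r → f (p · r) ≡ f p · f r) →
    ∀ m p r → iter f m (p · r) ≡ iter f m p · iter f m r
  iter-homomorphic f-hom zero    p r = refl
  iter-homomorphic f-hom (suc m) p r = trans (cong f (iter-homomorphic f-hom m p r)) (f-hom _ _)

least-positive : {P : Pred ℕ _} → Decidable P → ∀ {k} → 0 < k → P k →
  ∃[ c ] 0 < c × P c × (∀ m → 0 < m → m < c → ¬ P m)
least-positive {P} P? {k} = <-rec Goal search k
  where
  Goal : ℕ → Set
  Goal k = 0 < k → P k → ∃[ c ] 0 < c × P c × (∀ m → 0 < m → m < c → ¬ P m)

  search : ∀ k → (∀ {m} → m < k → Goal m) → Goal k
  search k below 0<k pk with anyUpTo? (λ m → (0 <? m) ×-dec P? m) k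
  ... | yes (m , m<k , 0<m , pm) = below m<k 0<m pm
  ... | no  none = k , 0<k , pk , λ m 0<m m<k pm → none (m , m<k , 0<m , pm)

module _ {A : Set} {f : A → A} where

  cycleLength-minimal : ∀ {x c m} → CycleLength f x c → 0 < m → iter f m x ≡ x → c ≤ m
  cycleLength-minimal (_ , _ , minimal) 0<m fix = ≮⇒≥ (λ m<c → minimal _ 0<m m<c fix)

  fixed⇒cycleLength-1 : ∀ {x} → f x ≡ x → CycleLength f x 1
  fixed⇒cycleLength-1 fx≡x = n<1+n 0 , fx≡x , λ { (suc _) _ (s≤s ()) }

  cycleLength-cong : ∀ {x y c} →
    (∀ m → iter f m x ≡ x → iter f m y ≡ y) → (∀ m → iter f m y ≡ y → iter f m x ≡ x) →
    CycleLength f x c → CycleLength f y c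
  cycleLength-cong {c = c} x⇒y y⇒x (0<c , fix , minimal) =
    0<c , x⇒y c fix , λ m 0<m m<c fix′ → minimal m 0<m m<c (y⇒x m fix′)

  noRepeatedCycleLengths⇒fixed-unique : NoRepeatedCycleLengths f →
    ∀ {x y} → f x ≡ x → f y ≡ y → x ≡ y
  noRepeatedCycleLengths⇒fixed-unique noRepeats fx≡x fy≡y
    with t , fᵗx≡y ← noRepeats _ _ 1 (fixed⇒cycleLength-1 fx≡x) (fixed⇒cycleLength-1 fy≡y)
    = trans (sym (iter-fixed fx≡x t)) fᵗx≡y

cycleLength-exists : ∀ {n} {f : Fin n → Fin n} → Injective _≡_ _≡_ f → ∀ x → ∃[ c ] CycleLength f x c
cycleLength-exists {n} {f} inj x with pigeonhole (n<1+n n) (λ i → iter f (toℕ i) x)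
... | i , j , i<j , fⁱx≡fʲx = least-positive (λ m → iter f m x ≟ x) (m<n⇒0<n∸m i<j) returns
  where
  returns : iter f (toℕ j ∸ toℕ i) x ≡ x
  returns = sym (iter-injective inj (toℕ i) (begin
    iter f (toℕ i) x                           ≡⟨ fⁱx≡fʲx ⟩
    iter f (toℕ j) x                           ≡⟨ cong (λ k → iter f k x) (sym (m+[n∸m]≡n (<⇒≤ i<j))) ⟩
    iter f (toℕ i + (toℕ j ∸ toℕ i)) x         ≡⟨ iter-+ (toℕ i) _ x ⟩
    iter f (toℕ i) (iter f (toℕ j ∸ toℕ i) x)  ∎))

module _ {n} {_∗_ : BinOp n} (quandle : IsQuandle _∗_) where
  open IsQuandle quandle

  _/_ : Fin n → Fin n → Fin n
  i / j = proj₁ (rightDiv i j)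

  /-∗ : ∀ i j → (i / j) ∗ j ≡ i
  /-∗ i j = proj₁ (proj₂ (rightDiv i j))

  R-injective : ∀ j → Injective _≡_ _≡_ (R _∗_ j)
  R-injective j {y} {z} yj≡zj = trans (unique y yj≡zj) (sym (unique z refl))
    where
    unique = proj₂ (proj₂ (rightDiv (z ∗ j) j))

  L-comm-R : ∀ e z → e ∗ (z ∗ e) ≡ (e ∗ z) ∗ e
  L-comm-R e z = trans (cong (_∗ (z ∗ e)) (sym (idem e))) (sym (selfDist e z e))

  module _ (noRepeats : ProfileNoRepeats _∗_) where

    R-fixed⇒≡ : ∀ {i j} → j ∗ i ≡ j → j ≡ i
    R-fixed⇒≡ {i} fixed = noRepeatedCycleLengths⇒fixed-unique (noRepeats i) fixed (idem i)

    module _ (e : Fin n) where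
      private
        ζ : Fin n → Fin n
        ζ = R _∗_ e

      L-fiber-stabilizer : ∀ {x x′} m → e ∗ x ≡ e ∗ x′ → iter ζ m x′ ≡ x′ → iter ζ m x ≡ x
      L-fiber-stabilizer {x} {x′} m ex≡ex′ fix′ = R-fixed⇒≡ (begin
        iter ζ m x ∗ x                ≡⟨ sym (/-∗ _ x′) ⟩
        u (iter ζ m x) ∗ x′           ≡⟨ cong (_∗ x′) (iter-commute u-comm-ζ m x) ⟩
        iter ζ m (u x) ∗ x′           ≡⟨ cong (iter ζ m (u x) ∗_) (sym fix′) ⟩
        iter ζ m (u x) ∗ iter ζ m x′  ≡⟨ sym (iter-homomorphic (λ p r → selfDist p r e) m (u x) x′) ⟩
        iter ζ m (u x ∗ x′)           ≡⟨ cong (iter ζ m) (/-∗ _ x′) ⟩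
        iter ζ m (x ∗ x)              ≡⟨ cong (iter ζ m) (idem x) ⟩
        iter ζ m x                    ∎)
        where
        u : Fin n → Fin n
        u z = (z ∗ x) / x′

        u-comm-ζ : ∀ z → u (z ∗ e) ≡ u z ∗ e
        u-comm-ζ z = R-injective x′ (begin
          u (z ∗ e) ∗ x′         ≡⟨ /-∗ _ x′ ⟩
          (z ∗ e) ∗ x            ≡⟨ selfDist z e x ⟩
          (z ∗ x) ∗ (e ∗ x)      ≡⟨ cong₂ _∗_ (sym (/-∗ _ x′)) ex≡ex′ ⟩
          (u z ∗ x′) ∗ (e ∗ x′)  ≡⟨ sym (selfDist (u z) e x′) ⟩
          (u z ∗ e) ∗ x′         ∎)

      preimage-in-cycle : ∀ {a d} → (∀ x → CycleLength ζ x d → CycleLength ζ (e ∗ x) d) →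
        CycleLength ζ a d → ∃[ t ] e ∗ iter ζ t a ≡ a
      preimage-in-cycle {a} {d} preserves cla with t , ζᵗea≡a ← noRepeats e (e ∗ a) a d (preserves a cla) cla =
        t , trans (iter-commute (L-comm-R e) t a) ζᵗea≡a

      preimage-in-cycle⇒stabilizer-reflect : ∀ {a x} m → ∃[ t ] e ∗ iter ζ t a ≡ a → e ∗ x ≡ a →
        iter ζ m a ≡ a → iter ζ m x ≡ x
      preimage-in-cycle⇒stabilizer-reflect m (t , eq) ex≡a fix =
        L-fiber-stabilizer m (trans ex≡a (sym eq)) (iter-iter-fixed t m fix)

      -- A shorter cycle for e ∗ x would, by induction, put e ∗ x in the image of its own cycle,
      -- and L-fiber-stabilizer would then shorten the cycle of x.
      L-preserves-cycleLength : ∀ c x → CycleLength ζ x c → CycleLength ζ (e ∗ x) c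
      L-preserves-cycleLength = <-rec _ step
        where
        step : ∀ c → (∀ {d} → d < c → ∀ x → CycleLength ζ x d → CycleLength ζ (e ∗ x) d) →
          ∀ x → CycleLength ζ x c → CycleLength ζ (e ∗ x) c
        step c shorter x (0<c , fix , minimal) with cycleLength-exists (R-injective e) (e ∗ x)
        ... | d , cla@(0<d , fixᵈ , _) = subst (CycleLength ζ (e ∗ x)) d≡c cla
          where
          d≮c : ¬ d < c
          d≮c d<c = minimal d 0<d d<c
            (preimage-in-cycle⇒stabilizer-reflect d (preimage-in-cycle (shorter d<c) cla) refl fixᵈ)

          d≡c : d ≡ c
          d≡c = ≤∧≮⇒≡ (cycleLength-minimal cla 0<c (iter-commute-fixed (L-comm-R e) c fix)) d≮c

      L-preimage-in-cycle : ∀ a → ∃[ t ] e ∗ iter ζ t a ≡ a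
      L-preimage-in-cycle a with c , cla ← cycleLength-exists (R-injective e) a =
        preimage-in-cycle (L-preserves-cycleLength c) cla

      L-surjective : Surjective _≡_ _≡_ (L _∗_ e)
      L-surjective = strictlySurjective⇒surjective λ a → _ , proj₂ (L-preimage-in-cycle a)

      L-injective : Injective _≡_ _≡_ (L _∗_ e)
      L-injective {x} {y} ex≡ey with c , clx ← cycleLength-exists (R-injective e) x
        with k , ζᵏx≡y ← noRepeats e x y c clx
               (cycleLength-cong (λ m → L-fiber-stabilizer m (sym ex≡ey)) (λ m → L-fiber-stabilizer m ex≡ey) clx) =
        trans (sym ζᵏx≡x) ζᵏx≡y
        where
        ζᵏex≡ex : iter ζ k (e ∗ x) ≡ e ∗ x
        ζᵏex≡ex = begin
          iter ζ k (e ∗ x)  ≡⟨ sym (iter-commute (L-comm-R e) k x) ⟩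
          e ∗ iter ζ k x    ≡⟨ cong (e ∗_) ζᵏx≡y ⟩
          e ∗ y             ≡⟨ sym ex≡ey ⟩
          e ∗ x             ∎

        ζᵏx≡x : iter ζ k x ≡ x
        ζᵏx≡x = preimage-in-cycle⇒stabilizer-reflect k (L-preimage-in-cycle (e ∗ x)) refl ζᵏex≡ex

corollary3p5 : (n : ℕ) (_∗_ : BinOp n) → IsQuandle _∗_ → Connected _∗_ →
    ProfileNoRepeats _∗_ → Latin _∗_
corollary3p5 n _∗_ quandle _ noRepeats e = L-injective quandle noRepeats e , L-surjective quandle noRepeats e
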